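{- Let $G$ be a digraph and let $u\to v$ be an arc of $G$. Let $\widetilde{G}$ be the digraph obtained from $G$ by removing the arc $u\to v$, adding four new vertices $u',u'',v',v''$, and adding the five arcs $u\to v''$, $u'\to v''$, $u'\to v'$, $u''\to v'$, $u''\to v$. If $G$ is an inter-nut digraph, then $\widetilde{G}$ is an inter-nut digraph that is not an ambi-nut digraph.
   Context: A digraph $G$ is a finite nonempty vertex set $V(G)$ with an arbitrary binary relation $\to$. $\operatorname{Ker}G=\{\mathbf{x}\colon V(G)\to\mathbb{R} : \sum_{w: z\to w}\mathbf{x}(w)=0\ \forall z\}$ and $\operatorname{CoKer}G=\{\mathbf{x} : \sum_{w:w\to z}\mathbf{x}(w)=0\ \forall z\}$ (kernels of the adjacency matrix and its transpose). A vector is full if it has no zero entry. $G$ is inter-nut if $\operatorname{Ker}G\cap\operatorname{CoKer}G$ is one-dimensional and spanned by a full vector; $G$ is ambi-nut if $\operatorname{Ker}G$ and $\operatorname{CoKer}G$ are both one-dimensional and spanned by the same full vector.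
   Formalization: The vectors of Ker G and CoKer G, and the scalars spanning them, take values in ℚ rather than ℝ, in both the inter-nut and the ambi-nut conditions. -}

module Defs where

open import Data.Nat using (ℕ; zero; suc; _+_)
open import Data.Fin using (Fin; zero; suc; splitAt; _≟_)
open import Data.Bool using (Bool; true; false; if_then_else_; _∧_)
open import Data.Sum using (inj₁; inj₂)
open import Data.Rational using (ℚ; 0ℚ; _*_) renaming (_+_ to _+ℚ_)
open import Data.Product using (Σ; _×_; ∃)
open import Relation.Binary.PropositionalEquality using (_≡_; _≢_)
open import Relation.Nullary.Decidable using (⌊_⌋)

-- A digraph on the vertex set Fin n, given by an arbitrary binary relation
-- (loops allowed), encoded as a Boolean adjacency function: adj z w ≡ true iff z → w.
record Digraph : Set where
  field
    n   : ℕ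
    adj : Fin n → Fin n → Bool
open Digraph public

Vector : Digraph → Set
Vector G = Fin (n G) → ℚ

Σᶠ : (m : ℕ) → (Fin m → ℚ) → ℚ
Σᶠ zero    f = 0ℚ
Σᶠ (suc m) f = f zero +ℚ Σᶠ m (λ i → f (suc i))

InKer : (G : Digraph) → Vector G → Set
InKer G x = ∀ z → Σᶠ (n G) (λ w → if adj G z w then x w else 0ℚ) ≡ 0ℚ

InCoKer : (G : Digraph) → Vector G → Set
InCoKer G x = ∀ z → Σᶠ (n G) (λ w → if adj G w z then x w else 0ℚ) ≡ 0ℚ

Full : (G : Digraph) → Vector G → Set
Full G x = ∀ w → x w ≢ 0ℚ

InSpan : (G : Digraph) → Vector G → Vector G → Set
InSpan G x y = ∃ λ (c : ℚ) → ∀ w → y w ≡ c * x w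

InterNut : Digraph → Set
InterNut G = Σ (Vector G) λ x →
  Full G x × InKer G x × InCoKer G x ×
  (∀ y → InKer G y → InCoKer G y → InSpan G x y)

AmbiNut : Digraph → Set
AmbiNut G = Σ (Vector G) λ x →
  Full G x × InKer G x × InCoKer G x ×
  (∀ y → InKer G y → InSpan G x y) ×
  (∀ y → InCoKer G y → InSpan G x y)

Arc : (G : Digraph) → Fin (n G) → Fin (n G) → Set
Arc G u v = adj G u v ≡ true

-- Vertex set Fin (n + 4): old vertices are the first n
-- (x ↦ x ↑ˡ 4), new ones are n+0 = u', n+1 = u'', n+2 = v', n+3 = v''.
private
  eqF : ∀ {m} → Fin m → Fin m → Bool
  eqF a b = ⌊ a ≟ b ⌋

  u′ u″ v′ v″ : Fin 4
  u′ = zero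
  u″ = suc zero
  v′ = suc (suc zero)
  v″ = suc (suc (suc zero))

tildeAdj : (G : Digraph) → Fin (n G) → Fin (n G) →
           Fin (n G + 4) → Fin (n G + 4) → Bool
tildeAdj G u v a b with splitAt (n G) a | splitAt (n G) b
... | inj₁ x | inj₁ y = if eqF x u ∧ eqF y v then false else adj G x y
... | inj₁ x | inj₂ j = eqF x u ∧ eqF j v″
... | inj₂ i | inj₁ y = eqF i u″ ∧ eqF y v
... | inj₂ i | inj₂ j = (eqF i u′ ∧ eqF j v″) Data.Bool.∨ ((eqF i u′ ∧ eqF j v′) Data.Bool.∨ (eqF i u″ ∧ eqF j v′))

tilde : (G : Digraph) → Fin (n G) → Fin (n G) → Digraph
tilde G u v = record { n = n G + 4 ; adj = tildeAdj G u v }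

{-# OPTIONS --safe #-}
-- The gadget replaces the arc u → v by the alternating path
-- u → v″ ← u′ → v′ ← u″ → v.  The kernel equations at u′ and u″ force
-- y(v″) = − y(v′) = y(v), so in the kernel equation at u the value of v″
-- stands in for the value of the removed out-neighbour v; dually, the
-- cokernel equations at v″ and v′ force y(u″) = − y(u′) = y(u).  Hence
-- restriction to the old vertices maps Ker ∩ CoKer of G̃ injectively into
-- Ker ∩ CoKer of G, and x ↦ x extended by (− x(u), x(u), − x(v), x(v)) on
-- (u′, u″, v′, v″) is its inverse, which keeps full vectors full.  But u′
-- has no in-arcs, so its indicator vector lies in Ker G̃ and is not a
-- multiple of a full vector.
module Submission where

open import Defs
open import Data.Fin using (Fin)
open import Data.Product using (_×_)
open import Relation.Nullary using (¬_)

open import Algebra.Bundles using (CommutativeMonoid)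
import Data.Rational.Properties as QP
open import Algebra.Properties.Group QP.+-0-group using (inverseʳ-unique)
open import Algebra.Properties.CommutativeSemigroup
  (CommutativeMonoid.commutativeSemigroup QP.+-0-commutativeMonoid) using (xy∙z≈zy∙x)
open import Data.Bool using (Bool; true; false; if_then_else_; _∧_; _∨_)
open import Data.Bool.Properties using (∧-zeroʳ; ∧-identityʳ)
open import Data.Fin using (zero; suc; _↑ˡ_; _↑ʳ_; splitAt; _≟_)
open import Data.Fin.Patterns using (0F; 1F; 2F; 3F)
open import Data.Fin.Properties using (splitAt-↑ˡ; splitAt-↑ʳ; join-splitAt; suc-injective; ↑ʳ-injective; 0≢1+n)
open import Data.Nat using (ℕ; zero; suc; _+_)
open import Data.Product using (_,_)
open import Data.Rational using (ℚ; 0ℚ; 1ℚ; -_; _*_; 1/_; ≢-nonZero) renaming (_+_ to _+ℚ_)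
open import Data.Sum using (inj₁; inj₂)
open import Data.Vec.Functional using (_++_)
open import Data.Vec.Functional.Properties using (lookup-++ˡ; lookup-++ʳ)
open import Function using (_∘_)
open import Relation.Binary.PropositionalEquality
open import Relation.Nullary.Decidable using (yes; no; ⌊_⌋; isYes≗does; dec-true; dec-false)
open ≡-Reasoning

⌊≟⌋-refl : ∀ {m} (i : Fin m) → ⌊ i ≟ i ⌋ ≡ true
⌊≟⌋-refl i = trans (isYes≗does (i ≟ i)) (dec-true (i ≟ i) refl)

⌊≟⌋-≢ : ∀ {m} {i j : Fin m} → i ≢ j → ⌊ i ≟ j ⌋ ≡ false
⌊≟⌋-≢ {i = i} {j} i≢j = trans (isYes≗does (i ≟ j)) (dec-false (i ≟ j) i≢j)

↑-elim : ∀ m k (P : Fin (m + k) → Set) →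
         (∀ i → P (i ↑ˡ k)) → (∀ j → P (m ↑ʳ j)) → ∀ a → P a
↑-elim m k P Pˡ Pʳ a with splitAt m a | join-splitAt m k a
... | inj₁ i | i↑ˡk≡a = subst P i↑ˡk≡a (Pˡ i)
... | inj₂ j | m↑ʳj≡a = subst P m↑ʳj≡a (Pʳ j)

p*q≡0⇒p≡0 : ∀ p {q} → q ≢ 0ℚ → p * q ≡ 0ℚ → p ≡ 0ℚ
p*q≡0⇒p≡0 p {q} q≢0 pq≡0 = begin
  p              ≡⟨ QP.*-identityʳ p ⟨
  p * 1ℚ         ≡⟨ cong (p *_) (QP.*-inverseʳ q) ⟨
  p * (q * 1/ q) ≡⟨ QP.*-assoc p q (1/ q) ⟨
  p * q * 1/ q   ≡⟨ cong (_* 1/ q) pq≡0 ⟩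
  0ℚ * 1/ q      ≡⟨ QP.*-zeroˡ (1/ q) ⟩
  0ℚ             ∎
  where instance _ = ≢-nonZero q≢0

Σᶠ-cong : ∀ m {f g : Fin m → ℚ} → (∀ i → f i ≡ g i) → Σᶠ m f ≡ Σᶠ m g
Σᶠ-cong zero    f≗g = refl
Σᶠ-cong (suc m) f≗g = cong₂ _+ℚ_ (f≗g zero) (Σᶠ-cong m (f≗g ∘ suc))

Σᶠ-zero : ∀ m {f : Fin m → ℚ} → (∀ i → f i ≡ 0ℚ) → Σᶠ m f ≡ 0ℚ
Σᶠ-zero zero    f≗0 = refl
Σᶠ-zero (suc m) f≗0 = trans (cong₂ _+ℚ_ (f≗0 zero) (Σᶠ-zero m (f≗0 ∘ suc))) (QP.+-identityˡ 0ℚ)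

Σᶠ-single : ∀ m {f : Fin m → ℚ} p → (∀ i → i ≢ p → f i ≡ 0ℚ) → Σᶠ m f ≡ f p
Σᶠ-single (suc m) {f} zero    f≗0 =
  trans (cong (f zero +ℚ_) (Σᶠ-zero m (λ i → f≗0 (suc i) (0≢1+n ∘ sym)))) (QP.+-identityʳ (f zero))
Σᶠ-single (suc m) {f} (suc p) f≗0 =
  trans (cong (_+ℚ Σᶠ m (f ∘ suc)) (f≗0 zero 0≢1+n))
        (trans (QP.+-identityˡ _) (Σᶠ-single m p (λ i i≢p → f≗0 (suc i) (i≢p ∘ suc-injective))))

Σᶠ-swap-at : ∀ m {f g : Fin m → ℚ} p → (∀ i → i ≢ p → f i ≡ g i) →
             Σᶠ m f +ℚ g p ≡ Σᶠ m g +ℚ f p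
Σᶠ-swap-at (suc m) {f} {g} zero f≗g = begin
  f 0F +ℚ Σᶠ m (f ∘ suc) +ℚ g 0F ≡⟨ cong (λ s → f 0F +ℚ s +ℚ g 0F) (Σᶠ-cong m f≗g′) ⟩
  f 0F +ℚ Σᶠ m (g ∘ suc) +ℚ g 0F ≡⟨ xy∙z≈zy∙x (f 0F) _ (g 0F) ⟩
  g 0F +ℚ Σᶠ m (g ∘ suc) +ℚ f 0F ∎
  where
  f≗g′ : ∀ i → f (suc i) ≡ g (suc i)
  f≗g′ i = f≗g (suc i) (0≢1+n ∘ sym)
Σᶠ-swap-at (suc m) {f} {g} (suc p) f≗g = begin
  f 0F +ℚ Σᶠ m (f ∘ suc) +ℚ g (suc p)   ≡⟨ QP.+-assoc (f 0F) _ _ ⟩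
  f 0F +ℚ (Σᶠ m (f ∘ suc) +ℚ g (suc p)) ≡⟨ cong₂ _+ℚ_ (f≗g zero 0≢1+n) (Σᶠ-swap-at m p f≗g′) ⟩
  g 0F +ℚ (Σᶠ m (g ∘ suc) +ℚ f (suc p)) ≡⟨ QP.+-assoc (g 0F) _ _ ⟨
  g 0F +ℚ Σᶠ m (g ∘ suc) +ℚ f (suc p)   ∎
  where
  f≗g′ : ∀ i → i ≢ p → f (suc i) ≡ g (suc i)
  f≗g′ i i≢p = f≗g (suc i) (i≢p ∘ suc-injective)

Σᶠ-++ : ∀ m k (f : Fin (m + k) → ℚ) →
        Σᶠ (m + k) f ≡ Σᶠ m (f ∘ (_↑ˡ k)) +ℚ Σᶠ k (f ∘ (m ↑ʳ_))
Σᶠ-++ zero    k f = sym (QP.+-identityˡ _)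
Σᶠ-++ (suc m) k f = trans (cong (f zero +ℚ_) (Σᶠ-++ m k (f ∘ suc))) (sym (QP.+-assoc (f zero) _ _))

Σ⟨_⟩ : ∀ {m} → (Fin m → Bool) → (Fin m → ℚ) → ℚ
Σ⟨_⟩ {m} b f = Σᶠ m (λ i → if b i then f i else 0ℚ)

Σ⟨⟩-congˡ : ∀ {m} {b c : Fin m → Bool} (f : Fin m → ℚ) → (∀ i → b i ≡ c i) →
            Σ⟨ b ⟩ f ≡ Σ⟨ c ⟩ f
Σ⟨⟩-congˡ {m} f b≗c = Σᶠ-cong m (λ i → cong (if_then f i else 0ℚ) (b≗c i))

Σ⟨⟩-congʳ : ∀ {m} (b : Fin m → Bool) {f g : Fin m → ℚ} → (∀ i → f i ≡ g i) →
            Σ⟨ b ⟩ f ≡ Σ⟨ b ⟩ g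
Σ⟨⟩-congʳ {m} b f≗g = Σᶠ-cong m (λ i → cong (if b i then_else 0ℚ) (f≗g i))

Σ⟨⟩-empty : ∀ {m} {b : Fin m → Bool} (f : Fin m → ℚ) → (∀ i → b i ≡ false) → Σ⟨ b ⟩ f ≡ 0ℚ
Σ⟨⟩-empty {m} f b≗false = Σᶠ-zero m (λ i → cong (if_then f i else 0ℚ) (b≗false i))

Σ⟨⟩-singleton : ∀ {m} {b : Fin m → Bool} (f : Fin m → ℚ) p → (∀ i → b i ≡ ⌊ i ≟ p ⌋) →
                Σ⟨ b ⟩ f ≡ f p
Σ⟨⟩-singleton {m} f p b≗p = begin
  Σ⟨ _ ⟩ f                        ≡⟨ Σ⟨⟩-congˡ f b≗p ⟩
  Σ⟨ (λ i → ⌊ i ≟ p ⌋) ⟩ f        ≡⟨ Σᶠ-single m p off-p ⟩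
  (if ⌊ p ≟ p ⌋ then f p else 0ℚ) ≡⟨ cong (if_then f p else 0ℚ) (⌊≟⌋-refl p) ⟩
  f p                             ∎
  where
  off-p : ∀ i → i ≢ p → (if ⌊ i ≟ p ⌋ then f i else 0ℚ) ≡ 0ℚ
  off-p i i≢p = cong (if_then f i else 0ℚ) (⌊≟⌋-≢ i≢p)

Σ⟨⟩-remove : ∀ {m} {b c : Fin m → Bool} (f : Fin m → ℚ) p → b p ≡ true → c p ≡ false →
             (∀ i → i ≢ p → c i ≡ b i) → Σ⟨ c ⟩ f +ℚ f p ≡ Σ⟨ b ⟩ f
Σ⟨⟩-remove {m} {b} {c} f p bp cp c≗b = begin
  Σ⟨ c ⟩ f +ℚ f p                         ≡⟨ cong (λ β → Σ⟨ c ⟩ f +ℚ (if β then f p else 0ℚ)) bp ⟨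
  Σ⟨ c ⟩ f +ℚ (if b p then f p else 0ℚ)   ≡⟨ Σᶠ-swap-at m p c≗b′ ⟩
  Σ⟨ b ⟩ f +ℚ (if c p then f p else 0ℚ)   ≡⟨ cong (λ β → Σ⟨ b ⟩ f +ℚ (if β then f p else 0ℚ)) cp ⟩
  Σ⟨ b ⟩ f +ℚ 0ℚ                          ≡⟨ QP.+-identityʳ _ ⟩
  Σ⟨ b ⟩ f                                 ∎
  where
  c≗b′ : ∀ i → i ≢ p → (if c i then f i else 0ℚ) ≡ (if b i then f i else 0ℚ)
  c≗b′ i i≢p = cong (if_then f i else 0ℚ) (c≗b i i≢p)

outSum inSum : (G : Digraph) → Vector G → Fin (n G) → ℚ
outSum G x z = Σ⟨ adj G z ⟩ x
inSum  G x z = Σ⟨ (λ w → adj G w z) ⟩ x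

IsSource : (G : Digraph) → Fin (n G) → Set
IsSource G w = ∀ z → adj G z w ≡ false

IsSink : (G : Digraph) → Fin (n G) → Set
IsSink G w = ∀ z → adj G w z ≡ false

indicator : ∀ {m} → Fin m → Fin m → ℚ
indicator w i = if ⌊ i ≟ w ⌋ then 1ℚ else 0ℚ

source⇒indicator∈Ker : ∀ G {w} → IsSource G w → InKer G (indicator w)
source⇒indicator∈Ker G {w} src z =
  trans (Σᶠ-single (n G) w off-w) (cong (if_then indicator w w else 0ℚ) (src z))
  where
  off-w : ∀ i → i ≢ w → (if adj G z i then indicator w i else 0ℚ) ≡ 0ℚ
  off-w i i≢w rewrite ⌊≟⌋-≢ i≢w with adj G z i
  ... | true  = refl
  ... | false = refl

source⇒¬AmbiNut : ∀ G {w w′} → w′ ≢ w → IsSource G w → ¬ AmbiNut G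
source⇒¬AmbiNut G {w} {w′} w′≢w src (x , full , _ , _ , kerSpanned , _)
  with kerSpanned (indicator w) (source⇒indicator∈Ker G src)
... | c , δ≗cx = 1≢0 (begin
  1ℚ             ≡⟨ cong (if_then 1ℚ else 0ℚ) (⌊≟⌋-refl w) ⟨
  indicator w w  ≡⟨ δ≗cx w ⟩
  c * x w        ≡⟨ cong (_* x w) c≡0 ⟩
  0ℚ * x w       ≡⟨ QP.*-zeroˡ (x w) ⟩
  0ℚ             ∎)
  where
  c≡0 : c ≡ 0ℚ
  c≡0 = p*q≡0⇒p≡0 c (full w′) (trans (sym (δ≗cx w′)) (cong (if_then 1ℚ else 0ℚ) (⌊≟⌋-≢ w′≢w)))
  1≢0 : 1ℚ ≢ 0ℚ
  1≢0 ()

module Subdivision (G : Digraph) (u v : Fin (n G)) where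

  N : ℕ
  N = n G

  G̃ : Digraph
  G̃ = tilde G u v

  old : Fin N → Fin (n G̃)
  old i = i ↑ˡ 4

  new : Fin 4 → Fin (n G̃)
  new j = N ↑ʳ j

  u′ u″ v′ v″ : Fin 4
  u′ = 0F
  u″ = 1F
  v′ = 2F
  v″ = 3F

  gadgetArc : Fin 4 → Fin 4 → Bool
  gadgetArc i j =
    (⌊ i ≟ u′ ⌋ ∧ ⌊ j ≟ v″ ⌋) ∨ ((⌊ i ≟ u′ ⌋ ∧ ⌊ j ≟ v′ ⌋) ∨ (⌊ i ≟ u″ ⌋ ∧ ⌊ j ≟ v′ ⌋))

  adj-old-old : ∀ z i → adj G̃ (old z) (old i) ≡ (if ⌊ z ≟ u ⌋ ∧ ⌊ i ≟ v ⌋ then false else adj G z i)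
  adj-old-old z i rewrite splitAt-↑ˡ N z 4 | splitAt-↑ˡ N i 4 = refl

  adj-old-new : ∀ z j → adj G̃ (old z) (new j) ≡ ⌊ z ≟ u ⌋ ∧ ⌊ j ≟ v″ ⌋
  adj-old-new z j rewrite splitAt-↑ˡ N z 4 | splitAt-↑ʳ N 4 j = refl

  adj-new-old : ∀ j i → adj G̃ (new j) (old i) ≡ ⌊ j ≟ u″ ⌋ ∧ ⌊ i ≟ v ⌋
  adj-new-old j i rewrite splitAt-↑ʳ N 4 j | splitAt-↑ˡ N i 4 = refl

  adj-new-new : ∀ j k → adj G̃ (new j) (new k) ≡ gadgetArc j k
  adj-new-new j k rewrite splitAt-↑ʳ N 4 j | splitAt-↑ʳ N 4 k = refl

  v′-sink : IsSink G̃ (new v′)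
  v′-sink = ↑-elim N 4 _ (adj-new-old v′) (adj-new-new v′)

  v″-sink : IsSink G̃ (new v″)
  v″-sink = ↑-elim N 4 _ (adj-new-old v″) (adj-new-new v″)

  u′-source : IsSource G̃ (new u′)
  u′-source = ↑-elim N 4 _ (λ z → trans (adj-old-new z u′) (∧-zeroʳ _)) λ where
    0F → adj-new-new 0F u′
    1F → adj-new-new 1F u′
    2F → adj-new-new 2F u′
    3F → adj-new-new 3F u′

  u″-source : IsSource G̃ (new u″)
  u″-source = ↑-elim N 4 _ (λ z → trans (adj-old-new z u″) (∧-zeroʳ _)) λ where
    0F → adj-new-new 0F u″
    1F → adj-new-new 1F u″
    2F → adj-new-new 2F u″
    3F → adj-new-new 3F u″

  Σ⟨gadget-from-u′⟩ : ∀ (f : Fin 4 → ℚ) → Σ⟨ gadgetArc u′ ⟩ f ≡ f v′ +ℚ f v″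
  Σ⟨gadget-from-u′⟩ f = begin
    Σ⟨ gadgetArc u′ ⟩ f                  ≡⟨⟩
    0ℚ +ℚ (0ℚ +ℚ (f v′ +ℚ (f v″ +ℚ 0ℚ))) ≡⟨ QP.+-identityˡ _ ⟩
    0ℚ +ℚ (f v′ +ℚ (f v″ +ℚ 0ℚ))         ≡⟨ QP.+-identityˡ _ ⟩
    f v′ +ℚ (f v″ +ℚ 0ℚ)                 ≡⟨ cong (f v′ +ℚ_) (QP.+-identityʳ _) ⟩
    f v′ +ℚ f v″                         ∎

  Σ⟨gadget-into-v′⟩ : ∀ (f : Fin 4 → ℚ) → Σ⟨ (λ j → gadgetArc j v′) ⟩ f ≡ f u′ +ℚ f u″
  Σ⟨gadget-into-v′⟩ f = begin
    Σ⟨ (λ j → gadgetArc j v′) ⟩ f        ≡⟨⟩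
    f u′ +ℚ (f u″ +ℚ (0ℚ +ℚ (0ℚ +ℚ 0ℚ))) ≡⟨ cong (λ s → f u′ +ℚ (f u″ +ℚ s)) (QP.+-identityˡ _) ⟩
    f u′ +ℚ (f u″ +ℚ (0ℚ +ℚ 0ℚ))         ≡⟨ cong (λ s → f u′ +ℚ (f u″ +ℚ s)) (QP.+-identityˡ 0ℚ) ⟩
    f u′ +ℚ (f u″ +ℚ 0ℚ)                 ≡⟨ cong (f u′ +ℚ_) (QP.+-identityʳ _) ⟩
    f u′ +ℚ f u″                         ∎

  module _ (Y : Vector G̃) where

    outSum-blocks : ∀ a {s t} →
                    Σ⟨ adj G̃ a ∘ old ⟩ (Y ∘ old) ≡ s → Σ⟨ adj G̃ a ∘ new ⟩ (Y ∘ new) ≡ t →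
                    outSum G̃ Y a ≡ s +ℚ t
    outSum-blocks a old-block new-block = trans (Σᶠ-++ N 4 _) (cong₂ _+ℚ_ old-block new-block)

    inSum-blocks : ∀ a {s t} →
                   Σ⟨ (λ i → adj G̃ (old i) a) ⟩ (Y ∘ old) ≡ s →
                   Σ⟨ (λ j → adj G̃ (new j) a) ⟩ (Y ∘ new) ≡ t →
                   inSum G̃ Y a ≡ s +ℚ t
    inSum-blocks a old-block new-block = trans (Σᶠ-++ N 4 _) (cong₂ _+ℚ_ old-block new-block)

    outSum-old : ∀ {z} → z ≢ u → outSum G̃ Y (old z) ≡ outSum G (Y ∘ old) z
    outSum-old {z} z≢u =
      trans (outSum-blocks (old z) (Σ⟨⟩-congˡ (Y ∘ old) old-part) (Σ⟨⟩-empty (Y ∘ new) new-part))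
            (QP.+-identityʳ _)
      where
      old-part : ∀ i → adj G̃ (old z) (old i) ≡ adj G z i
      old-part i rewrite adj-old-old z i | ⌊≟⌋-≢ z≢u = refl
      new-part : ∀ j → adj G̃ (old z) (new j) ≡ false
      new-part j rewrite adj-old-new z j | ⌊≟⌋-≢ z≢u = refl

    outSum-old-u : Arc G u v → Y (new v″) ≡ Y (old v) → outSum G̃ Y (old u) ≡ outSum G (Y ∘ old) u
    outSum-old-u arc v″≡v =
      trans (outSum-blocks (old u) refl (trans (Σ⟨⟩-singleton (Y ∘ new) v″ new-part) v″≡v))
            (Σ⟨⟩-remove (Y ∘ old) v arc uv-removed old-part)
      where
      old-part : ∀ i → i ≢ v → adj G̃ (old u) (old i) ≡ adj G u i
      old-part i i≢v rewrite adj-old-old u i | ⌊≟⌋-refl u | ⌊≟⌋-≢ i≢v = refl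
      uv-removed : adj G̃ (old u) (old v) ≡ false
      uv-removed rewrite adj-old-old u v | ⌊≟⌋-refl u | ⌊≟⌋-refl v = refl
      new-part : ∀ j → adj G̃ (old u) (new j) ≡ ⌊ j ≟ v″ ⌋
      new-part j rewrite adj-old-new u j | ⌊≟⌋-refl u = refl

    outSum-u′ : outSum G̃ Y (new u′) ≡ Y (new v′) +ℚ Y (new v″)
    outSum-u′ =
      trans (outSum-blocks (new u′) (Σ⟨⟩-empty (Y ∘ old) (adj-new-old u′)) new-block) (QP.+-identityˡ _)
      where
      new-block : Σ⟨ adj G̃ (new u′) ∘ new ⟩ (Y ∘ new) ≡ Y (new v′) +ℚ Y (new v″)
      new-block = trans (Σ⟨⟩-congˡ (Y ∘ new) (adj-new-new u′)) (Σ⟨gadget-from-u′⟩ (Y ∘ new))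

    outSum-u″ : outSum G̃ Y (new u″) ≡ Y (old v) +ℚ Y (new v′)
    outSum-u″ = outSum-blocks (new u″) (Σ⟨⟩-singleton (Y ∘ old) v (adj-new-old u″))
                                       (Σ⟨⟩-singleton (Y ∘ new) v′ (adj-new-new u″))

    inSum-old : ∀ {z} → z ≢ v → inSum G̃ Y (old z) ≡ inSum G (Y ∘ old) z
    inSum-old {z} z≢v =
      trans (inSum-blocks (old z) (Σ⟨⟩-congˡ (Y ∘ old) old-part) (Σ⟨⟩-empty (Y ∘ new) new-part))
            (QP.+-identityʳ _)
      where
      old-part : ∀ i → adj G̃ (old i) (old z) ≡ adj G i z
      old-part i rewrite adj-old-old i z | ⌊≟⌋-≢ z≢v | ∧-zeroʳ ⌊ i ≟ u ⌋ = refl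
      new-part : ∀ j → adj G̃ (new j) (old z) ≡ false
      new-part j rewrite adj-new-old j z | ⌊≟⌋-≢ z≢v = ∧-zeroʳ _

    inSum-old-v : Arc G u v → Y (new u″) ≡ Y (old u) → inSum G̃ Y (old v) ≡ inSum G (Y ∘ old) v
    inSum-old-v arc u″≡u =
      trans (inSum-blocks (old v) refl (trans (Σ⟨⟩-singleton (Y ∘ new) u″ new-part) u″≡u))
            (Σ⟨⟩-remove (Y ∘ old) u arc uv-removed old-part)
      where
      old-part : ∀ i → i ≢ u → adj G̃ (old i) (old v) ≡ adj G i v
      old-part i i≢u rewrite adj-old-old i v | ⌊≟⌋-≢ i≢u = refl
      uv-removed : adj G̃ (old u) (old v) ≡ false
      uv-removed rewrite adj-old-old u v | ⌊≟⌋-refl u | ⌊≟⌋-refl v = refl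
      new-part : ∀ j → adj G̃ (new j) (old v) ≡ ⌊ j ≟ u″ ⌋
      new-part j rewrite adj-new-old j v | ⌊≟⌋-refl v = ∧-identityʳ _

    inSum-v″ : inSum G̃ Y (new v″) ≡ Y (old u) +ℚ Y (new u′)
    inSum-v″ =
      inSum-blocks (new v″) (Σ⟨⟩-singleton (Y ∘ old) u old-part) (Σ⟨⟩-singleton (Y ∘ new) u′ new-part)
      where
      old-part : ∀ i → adj G̃ (old i) (new v″) ≡ ⌊ i ≟ u ⌋
      old-part i = trans (adj-old-new i v″) (∧-identityʳ _)
      new-part : ∀ j → adj G̃ (new j) (new v″) ≡ ⌊ j ≟ u′ ⌋
      new-part 0F = adj-new-new 0F v″
      new-part 1F = adj-new-new 1F v″
      new-part 2F = adj-new-new 2F v″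
      new-part 3F = adj-new-new 3F v″

    inSum-v′ : inSum G̃ Y (new v′) ≡ Y (new u′) +ℚ Y (new u″)
    inSum-v′ =
      trans (inSum-blocks (new v′) (Σ⟨⟩-empty (Y ∘ old) old-part) new-block) (QP.+-identityˡ _)
      where
      old-part : ∀ i → adj G̃ (old i) (new v′) ≡ false
      old-part i = trans (adj-old-new i v′) (∧-zeroʳ _)
      new-block : Σ⟨ (λ j → adj G̃ (new j) (new v′)) ⟩ (Y ∘ new) ≡ Y (new u′) +ℚ Y (new u″)
      new-block = trans (Σ⟨⟩-congˡ (Y ∘ new) (λ j → adj-new-new j v′)) (Σ⟨gadget-into-v′⟩ (Y ∘ new))

  ker⇒v″≡v : ∀ {Y} → InKer G̃ Y → Y (new v″) ≡ Y (old v)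
  ker⇒v″≡v {Y} ker =
    trans (inverseʳ-unique (Y (new v′)) _ v′+v″≡0) (sym (inverseʳ-unique (Y (new v′)) _ v′+v≡0))
    where
    v′+v″≡0 : Y (new v′) +ℚ Y (new v″) ≡ 0ℚ
    v′+v″≡0 = trans (sym (outSum-u′ Y)) (ker (new u′))
    v′+v≡0 : Y (new v′) +ℚ Y (old v) ≡ 0ℚ
    v′+v≡0 = trans (QP.+-comm (Y (new v′)) (Y (old v))) (trans (sym (outSum-u″ Y)) (ker (new u″)))

  coker⇒u″≡u : ∀ {Y} → InCoKer G̃ Y → Y (new u″) ≡ Y (old u)
  coker⇒u″≡u {Y} coker =
    trans (inverseʳ-unique (Y (new u′)) _ u′+u″≡0) (sym (inverseʳ-unique (Y (new u′)) _ u′+u≡0))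
    where
    u′+u″≡0 : Y (new u′) +ℚ Y (new u″) ≡ 0ℚ
    u′+u″≡0 = trans (sym (inSum-v′ Y)) (coker (new v′))
    u′+u≡0 : Y (new u′) +ℚ Y (old u) ≡ 0ℚ
    u′+u≡0 = trans (QP.+-comm (Y (new u′)) (Y (old u))) (trans (sym (inSum-v″ Y)) (coker (new v″)))

  outSum-old-balanced : Arc G u v → ∀ {Y} → Y (new v″) ≡ Y (old v) →
                        ∀ z → outSum G̃ Y (old z) ≡ outSum G (Y ∘ old) z
  outSum-old-balanced arc {Y} v″≡v z with z ≟ u
  ... | yes refl = outSum-old-u Y arc v″≡v
  ... | no z≢u   = outSum-old Y z≢u

  inSum-old-balanced : Arc G u v → ∀ {Y} → Y (new u″) ≡ Y (old u) →
                       ∀ z → inSum G̃ Y (old z) ≡ inSum G (Y ∘ old) z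
  inSum-old-balanced arc {Y} u″≡u z with z ≟ v
  ... | yes refl = inSum-old-v Y arc u″≡u
  ... | no z≢v   = inSum-old Y z≢v

  restrict-ker : Arc G u v → ∀ {Y} → InKer G̃ Y → InKer G (Y ∘ old)
  restrict-ker arc ker z = trans (sym (outSum-old-balanced arc (ker⇒v″≡v ker) z)) (ker (old z))

  restrict-coker : Arc G u v → ∀ {Y} → InCoKer G̃ Y → InCoKer G (Y ∘ old)
  restrict-coker arc coker z = trans (sym (inSum-old-balanced arc (coker⇒u″≡u coker) z)) (coker (old z))

  gadgetValues : Vector G → Fin 4 → ℚ
  gadgetValues x 0F = - x u
  gadgetValues x 1F = x u
  gadgetValues x 2F = - x v
  gadgetValues x 3F = x v

  extend : Vector G → Vector G̃
  extend x = x ++ gadgetValues x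

  extend-old : ∀ x i → extend x (old i) ≡ x i
  extend-old x = lookup-++ˡ x (gadgetValues x)

  extend-new : ∀ x j → extend x (new j) ≡ gadgetValues x j
  extend-new x = lookup-++ʳ x (gadgetValues x)

  extend-full : ∀ {x} → Full G x → Full G̃ (extend x)
  extend-full {x} full = ↑-elim N 4 (λ a → extend x a ≢ 0ℚ)
    (λ i → subst (_≢ 0ℚ) (sym (extend-old x i)) (full i))
    (λ j → subst (_≢ 0ℚ) (sym (extend-new x j)) (gadget-full j))
    where
    gadget-full : ∀ j → gadgetValues x j ≢ 0ℚ
    gadget-full 0F = full u ∘ QP.neg-injective
    gadget-full 1F = full u
    gadget-full 2F = full v ∘ QP.neg-injective
    gadget-full 3F = full v

  extend-ker : Arc G u v → ∀ {x} → InKer G x → InKer G̃ (extend x)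
  extend-ker arc {x} ker = ↑-elim N 4 (λ a → outSum G̃ (extend x) a ≡ 0ℚ) old-row new-row
    where
    old-row : ∀ z → outSum G̃ (extend x) (old z) ≡ 0ℚ
    old-row z = begin
      outSum G̃ (extend x) (old z)    ≡⟨ outSum-old-balanced arc (trans (extend-new x v″) (sym (extend-old x v))) z ⟩
      outSum G (extend x ∘ old) z    ≡⟨ Σ⟨⟩-congʳ (adj G z) (extend-old x) ⟩
      outSum G x z                   ≡⟨ ker z ⟩
      0ℚ                             ∎
    new-row : ∀ j → outSum G̃ (extend x) (new j) ≡ 0ℚ
    new-row 0F = trans (outSum-u′ _) (trans (cong₂ _+ℚ_ (extend-new x v′) (extend-new x v″)) (QP.+-inverseˡ (x v)))
    new-row 1F = trans (outSum-u″ _) (trans (cong₂ _+ℚ_ (extend-old x v) (extend-new x v′)) (QP.+-inverseʳ (x v)))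
    new-row 2F = Σ⟨⟩-empty (extend x) v′-sink
    new-row 3F = Σ⟨⟩-empty (extend x) v″-sink

  extend-coker : Arc G u v → ∀ {x} → InCoKer G x → InCoKer G̃ (extend x)
  extend-coker arc {x} coker = ↑-elim N 4 (λ a → inSum G̃ (extend x) a ≡ 0ℚ) old-column new-column
    where
    old-column : ∀ z → inSum G̃ (extend x) (old z) ≡ 0ℚ
    old-column z = begin
      inSum G̃ (extend x) (old z)    ≡⟨ inSum-old-balanced arc (trans (extend-new x u″) (sym (extend-old x u))) z ⟩
      inSum G (extend x ∘ old) z    ≡⟨ Σ⟨⟩-congʳ (λ w → adj G w z) (extend-old x) ⟩
      inSum G x z                   ≡⟨ coker z ⟩
      0ℚ                            ∎
    new-column : ∀ j → inSum G̃ (extend x) (new j) ≡ 0ℚ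
    new-column 0F = Σ⟨⟩-empty (extend x) u′-source
    new-column 1F = Σ⟨⟩-empty (extend x) u″-source
    new-column 2F = trans (inSum-v′ _) (trans (cong₂ _+ℚ_ (extend-new x u′) (extend-new x u″)) (QP.+-inverseˡ (x u)))
    new-column 3F = trans (inSum-v″ _) (trans (cong₂ _+ℚ_ (extend-old x u) (extend-new x u′)) (QP.+-inverseʳ (x u)))

  ker∩coker⇒extend : ∀ {Y} → InKer G̃ Y → InCoKer G̃ Y → ∀ a → Y a ≡ extend (Y ∘ old) a
  ker∩coker⇒extend {Y} ker coker = ↑-elim N 4 (λ a → Y a ≡ extend (Y ∘ old) a)
    (λ i → sym (extend-old (Y ∘ old) i))
    (λ j → trans (gadget-values j) (sym (extend-new (Y ∘ old) j)))
    where
    gadget-values : ∀ j → Y (new j) ≡ gadgetValues (Y ∘ old) j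
    gadget-values 0F = inverseʳ-unique (Y (old u)) _ (trans (sym (inSum-v″ Y)) (coker (new v″)))
    gadget-values 1F = coker⇒u″≡u coker
    gadget-values 2F = inverseʳ-unique (Y (old v)) _ (trans (sym (outSum-u″ Y)) (ker (new u″)))
    gadget-values 3F = ker⇒v″≡v ker

  extend-span : ∀ {x y} → InSpan G x y → InSpan G̃ (extend x) (extend y)
  extend-span {x} {y} (c , y≗cx) = c , ↑-elim N 4 (λ a → extend y a ≡ c * extend x a)
    (λ i → trans (extend-old y i) (trans (y≗cx i) (cong (c *_) (sym (extend-old x i)))))
    (λ j → trans (extend-new y j) (trans (gadget-span j) (cong (c *_) (sym (extend-new x j)))))
    where
    gadget-span : ∀ j → gadgetValues y j ≡ c * gadgetValues x j
    gadget-span 0F = trans (cong -_ (y≗cx u)) (QP.neg-distribʳ-* c (x u))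
    gadget-span 1F = y≗cx u
    gadget-span 2F = trans (cong -_ (y≗cx v)) (QP.neg-distribʳ-* c (x v))
    gadget-span 3F = y≗cx v

  extend-spans-ker∩coker : Arc G u v → ∀ {x} → (∀ y → InKer G y → InCoKer G y → InSpan G x y) →
                           ∀ Y → InKer G̃ Y → InCoKer G̃ Y → InSpan G̃ (extend x) Y
  extend-spans-ker∩coker arc spanned Y ker coker
    with extend-span (spanned (Y ∘ old) (restrict-ker arc ker) (restrict-coker arc coker))
  ... | c , extend≗c·extend = c , λ a → trans (ker∩coker⇒extend ker coker a) (extend≗c·extend a)

  u″≢u′ : new u″ ≢ new u′
  u″≢u′ = 0≢1+n ∘ sym ∘ ↑ʳ-injective N u″ u′

theorem26 : (G : Digraph) (u v : Fin (n G)) → Arc G u v →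
    InterNut G → InterNut (tilde G u v) × ¬ AmbiNut (tilde G u v)
theorem26 G u v arc (x , full , ker , coker , spanned) =
    (extend x , extend-full full , extend-ker arc ker , extend-coker arc coker ,
     extend-spans-ker∩coker arc spanned)
  , source⇒¬AmbiNut G̃ u″≢u′ u′-source
  where open Subdivision G u v
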